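{- For every cycle $C_n$ ($n\ge 3$), $PRC(C_n)\leq 6$.
   Context: All graphs are simple, finite and undirected. A set $S\subseteq V(G)$ is a dominating set if every vertex not in $S$ has a neighbor in $S$; $S$ is a perfect dominating set if every vertex in $V(G)\setminus S$ has exactly one neighbor in $S$. A perfect coalition in $G$ consists of two disjoint sets $V_1,V_2$ of vertices such that (i) neither $V_1$ nor $V_2$ is a dominating set of $G$; (ii) each vertex in $V(G)\setminus V_1$ has at most one neighbor in $V_1$, and each vertex in $V(G)\setminus V_2$ has at most one neighbor in $V_2$; (iii) $V_1\cup V_2$ is a perfect dominating set of $G$. A perfect coalition partition ($prc$-partition) of $G$ is a vertex partition $\pi=\{V_1,\dots,V_k\}$ such that each $V_i$ either is a singleton dominating set or forms a perfect coalition with some $V_j\in\pi$. $PRC(G)$ is the maximum cardinality of a $prc$-partition of $G$, with $PRC(G)=0$ if $G$ has no $prc$-partition. $C_n$ denotes the cycle on $n$ vertices. -}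

module Defs where

open import Data.Nat using (ℕ; zero; suc)
open import Data.Fin using (Fin; toℕ)
open import Data.Product using (Σ; ∃; _×_; _,_)
open import Data.Sum using (_⊎_)
open import Data.Empty using (⊥)
open import Relation.Nullary using (¬_)
open import Relation.Binary.PropositionalEquality using (_≡_; _≢_)
open import Function.Definitions using (Surjective)

Graph : ℕ → Set₁
Graph n = Fin n → Fin n → Set

VSet : ℕ → Set₁
VSet n = Fin n → Set

Cycle : (n : ℕ) → Graph n
Cycle n i j =
  (toℕ j ≡ suc (toℕ i)) ⊎ (toℕ i ≡ suc (toℕ j)) ⊎
  ((toℕ j ≡ 0 × suc (toℕ i) ≡ n) ⊎ (toℕ i ≡ 0 × suc (toℕ j) ≡ n))

module _ {n : ℕ} (G : Graph n) where

  Dominating : VSet n → Set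
  Dominating S = ∀ v → ¬ S v → Σ (Fin n) λ u → S u × G v u

  AtMostOneNbr : VSet n → Set
  AtMostOneNbr S = ∀ v → ¬ S v → ∀ u w → S u → G v u → S w → G v w → u ≡ w

  PerfectDominating : VSet n → Set
  PerfectDominating S =
    ∀ v → ¬ S v → Σ (Fin n) λ u → S u × G v u × (∀ w → S w → G v w → w ≡ u)

  _∪_ : VSet n → VSet n → VSet n
  (A ∪ B) v = A v ⊎ B v

  PerfectCoalition : VSet n → VSet n → Set
  PerfectCoalition A B =
    (∀ v → A v → B v → ⊥) ×
    ¬ Dominating A × ¬ Dominating B ×
    AtMostOneNbr A × AtMostOneNbr B ×
    PerfectDominating (A ∪ B)

  -- A vertex partition into k (nonempty) classes, given by a surjective class map.
  -- Class i is { v | f v ≡ i }.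
  Class : {k : ℕ} → (Fin n → Fin k) → Fin k → VSet n
  Class f i v = f v ≡ i

  SingletonDominating : VSet n → Set
  SingletonDominating S = (Σ (Fin n) λ v → ∀ w → (S w → w ≡ v) × (w ≡ v → S w)) × Dominating S

  IsPRCPartition : (k : ℕ) → (Fin n → Fin k) → Set
  IsPRCPartition k f =
    Surjective _≡_ _≡_ f ×
    (∀ i → SingletonDominating (Class f i)
           ⊎ Σ (Fin k) λ j → (j ≢ i) × PerfectCoalition (Class f i) (Class f j))

{-# OPTIONS --safe #-}
-- Call classes i and j partners, i ~ j, when they form a perfect coalition. For n ≥ 4 no single
-- vertex dominates C_n, so every class has a partner, and since the union of two partners
-- dominates, every partner pair contains one of the classes around any vertex. Hence:
--  * a class c has at most two partners. As c does not dominate, it misses the closed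
--    neighbourhood of some vertex z. If c contained next (next z), every partner d of c would be
--    the class of prev z or of next z (were d the class of z, next z would have two neighbours in
--    the perfect dominating set c ∪ d), impossible for three partners. So c also misses the
--    neighbourhood of next z and, going round the cycle, c would be empty;
--  * no class z lies outside three pairwise disjoint partner pairs, as all three pairs would
--    have to meet the two neighbours of a vertex of class z;
--  * every partner pair meets the three hub classes around vertex 0.
-- With seven classes or more, at least four classes are not hubs and all their partners are
-- hubs; as a hub has at most two partners, this always yields three disjoint partner pairs and
-- a seventh class outside them.
module Submission where

open import Defs
open import Data.Nat using (ℕ; zero; suc; _≤_; _<_; s≤s; _≤?_)
import Data.Nat.Properties as ℕ
open import Data.Nat.Properties using (≤-trans; <⇒≱; ≰⇒>; m≤n⇒m<n∨m≡n; m≤m+n)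
open import Data.Fin using (Fin; zero; suc; toℕ; fromℕ; inject₁; lower₁)
open import Data.Fin.Properties
  using (toℕ-injective; toℕ-fromℕ; toℕ-inject₁; inject₁-injective; fromℕ≢inject₁; inject₁-lower₁;
         suc-injective; injective⇒≤; ¬∀⟶∃¬; ≤fromℕ; _≟_)
open import Data.Fin.Induction using (<-weakInduction; <-weakInduction-startingFrom)
open import Data.List using (List; []; _∷_; length; lookup)
open import Data.List.Membership.Propositional using (_∈_)
open import Data.List.Relation.Unary.All using (All; []; _∷_)
open import Data.List.Relation.Unary.All.Properties using (¬Any⇒All¬)
open import Data.List.Relation.Unary.Any using (index; any?)
open import Data.List.Relation.Unary.Any.Properties using (lookup-index)
open import Data.Product using (∃; _×_; _,_; proj₁; proj₂)
import Data.Product as Product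
open import Data.Sum using (_⊎_; inj₁; inj₂; [_,_])
import Data.Sum as Sum
open import Data.Empty using (⊥; ⊥-elim)
open import Function using (_∘_)
open import Function.Definitions using (Surjective)
open import Relation.Nullary using (¬_; Dec; yes; no)
open import Relation.Nullary.Decidable using (_⊎-dec_; True; toWitness)
open import Relation.Binary.PropositionalEquality
  using (_≡_; _≢_; refl; sym; trans; cong; subst; ≢-sym; module ≡-Reasoning)

variable
  m k : ℕ

module _ {A : Set} where

  infix 4 _∈₂_ _∈₃_

  _∈₂_ : A → A × A → Set
  x ∈₂ (a , b) = x ≡ a ⊎ x ≡ b

  _∈₃_ : A → A × A × A → Set
  x ∈₃ (a , bc) = x ≡ a ⊎ x ∈₂ bc

  Disjoint : A × A → A × A → Set
  Disjoint (a , b) (c , d) = a ≢ c × a ≢ d × b ≢ c × b ≢ d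

  ¬three-distinct-in-pair : ∀ {d₁ d₂ d₃ a b} → d₁ ≢ d₂ → d₁ ≢ d₃ → d₂ ≢ d₃ →
    d₁ ∈₂ (a , b) → d₂ ∈₂ (a , b) → d₃ ∈₂ (a , b) → ⊥
  ¬three-distinct-in-pair d₁≢d₂ _     _     (inj₁ refl) (inj₁ refl) _           = d₁≢d₂ refl
  ¬three-distinct-in-pair _     d₁≢d₃ _     (inj₁ refl) (inj₂ refl) (inj₁ refl) = d₁≢d₃ refl
  ¬three-distinct-in-pair _     _     d₂≢d₃ (inj₁ refl) (inj₂ refl) (inj₂ refl) = d₂≢d₃ refl
  ¬three-distinct-in-pair _     _     d₂≢d₃ (inj₂ refl) (inj₁ refl) (inj₁ refl) = d₂≢d₃ refl
  ¬three-distinct-in-pair _     d₁≢d₃ _     (inj₂ refl) (inj₁ refl) (inj₂ refl) = d₁≢d₃ refl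
  ¬three-distinct-in-pair d₁≢d₂ _     _     (inj₂ refl) (inj₂ refl) _           = d₁≢d₂ refl

  ¬common-element : ∀ {a b c d x} → Disjoint (a , b) (c , d) → x ∈₂ (a , b) → x ∈₂ (c , d) → ⊥
  ¬common-element (a≢c , _ , _ , _) (inj₁ refl) (inj₁ refl) = a≢c refl
  ¬common-element (_ , a≢d , _ , _) (inj₁ refl) (inj₂ refl) = a≢d refl
  ¬common-element (_ , _ , b≢c , _) (inj₂ refl) (inj₁ refl) = b≢c refl
  ¬common-element (_ , _ , _ , b≢d) (inj₂ refl) (inj₂ refl) = b≢d refl

  ¬three-disjoint-meeting-pair : ∀ {p₁ p₂ p₃ l r} →
    Disjoint p₁ p₂ → Disjoint p₁ p₃ → Disjoint p₂ p₃ →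
    l ∈₂ p₁ ⊎ r ∈₂ p₁ → l ∈₂ p₂ ⊎ r ∈₂ p₂ → l ∈₂ p₃ ⊎ r ∈₂ p₃ → ⊥
  ¬three-disjoint-meeting-pair p₁₂ _   _   (inj₁ l∈₁) (inj₁ l∈₂) _          = ¬common-element p₁₂ l∈₁ l∈₂
  ¬three-disjoint-meeting-pair p₁₂ _   _   (inj₂ r∈₁) (inj₂ r∈₂) _          = ¬common-element p₁₂ r∈₁ r∈₂
  ¬three-disjoint-meeting-pair _   p₁₃ _   (inj₁ l∈₁) (inj₂ _)   (inj₁ l∈₃) = ¬common-element p₁₃ l∈₁ l∈₃
  ¬three-disjoint-meeting-pair _   _   p₂₃ (inj₁ _)   (inj₂ r∈₂) (inj₂ r∈₃) = ¬common-element p₂₃ r∈₂ r∈₃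
  ¬three-disjoint-meeting-pair _   _   p₂₃ (inj₂ _)   (inj₁ l∈₂) (inj₁ l∈₃) = ¬common-element p₂₃ l∈₂ l∈₃
  ¬three-disjoint-meeting-pair _   p₁₃ _   (inj₂ r∈₁) (inj₁ _)   (inj₂ r∈₃) = ¬common-element p₁₃ r∈₁ r∈₃

fresh : (xs : List (Fin k)) → length xs < k → ∃ λ y → All (y ≢_) xs
fresh {k} xs |xs|<k = Product.map₂ (¬Any⇒All¬ xs) (¬∀⟶∃¬ k (_∈ xs) (λ y → any? (y ≟_) xs) ¬all∈)
  where
  ¬all∈ : ¬ (∀ y → y ∈ xs)
  ¬all∈ all∈ = <⇒≱ |xs|<k (injective⇒≤ position-injective)
    where
    open ≡-Reasoning
    position-injective : ∀ {y y′} → index (all∈ y) ≡ index (all∈ y′) → y ≡ y′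
    position-injective {y} {y′} eq = begin
      y                           ≡⟨ lookup-index (all∈ y) ⟩
      lookup xs (index (all∈ y))  ≡⟨ cong (lookup xs) eq ⟩
      lookup xs (index (all∈ y′)) ≡⟨ lookup-index (all∈ y′) ⟨
      y′                          ∎

surjective⇒≤ : ∀ {f : Fin m → Fin k} → Surjective _≡_ _≡_ f → k ≤ m
surjective⇒≤ {f = f} surj = injective⇒≤ section-injective
  where
  section-injective : ∀ {y y′} → proj₁ (surj y) ≡ proj₁ (surj y′) → y ≡ y′
  section-injective {y} {y′} eq =
    trans (sym (proj₂ (surj y) refl)) (trans (cong f eq) (proj₂ (surj y′) refl))

prev : Fin (suc m) → Fin (suc m)
prev {m} zero = fromℕ m
prev (suc i)  = inject₁ i

next : Fin (suc m) → Fin (suc m)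
next {m} i with m ℕ.≟ toℕ i
... | yes _  = zero
... | no m≢i = suc (lower₁ i m≢i)

prev-injective : ∀ {i j : Fin (suc m)} → prev i ≡ prev j → i ≡ j
prev-injective {i = zero}  {zero}  _  = refl
prev-injective {i = zero}  {suc j} eq = ⊥-elim (fromℕ≢inject₁ eq)
prev-injective {i = suc i} {zero}  eq = ⊥-elim (fromℕ≢inject₁ (sym eq))
prev-injective {i = suc i} {suc j} eq = cong suc (inject₁-injective eq)

prev-next : (i : Fin (suc m)) → prev (next i) ≡ i
prev-next {m} i with m ℕ.≟ toℕ i
... | yes m≡i = toℕ-injective (trans (toℕ-fromℕ m) m≡i)
... | no m≢i  = inject₁-lower₁ i m≢i

next-prev : (i : Fin (suc m)) → next (prev i) ≡ i
next-prev i = prev-injective (prev-next (prev i))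

inject₁²≢suc² : ∀ {n} (i : Fin n) → inject₁ (inject₁ i) ≢ suc (suc i)
inject₁²≢suc² zero    ()
inject₁²≢suc² (suc i) eq = inject₁²≢suc² i (suc-injective eq)

prev∘prev≢id : 2 ≤ m → (z : Fin (suc m)) → prev (prev z) ≢ z
prev∘prev≢id (s≤s (s≤s _)) zero          ()
prev∘prev≢id (s≤s (s≤s _)) (suc zero)    ()
prev∘prev≢id (s≤s (s≤s _)) (suc (suc i)) = inject₁²≢suc² i

next∘next≢id : 2 ≤ m → (z : Fin (suc m)) → next (next z) ≢ z
next∘next≢id 2≤m z eq = prev∘prev≢id 2≤m z (begin
  prev (prev z)                ≡⟨ cong (prev ∘ prev) eq ⟨
  prev (prev (next (next z)))  ≡⟨ cong prev (prev-next (next z)) ⟩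
  prev (next z)                ≡⟨ prev-next z ⟩
  z                            ∎)
  where open ≡-Reasoning

next-closed⇒universal : (P : Fin (suc m) → Set) → (∀ z → P z → P (next z)) →
  ∀ {z₀} → P z₀ → ∀ z → P z
next-closed⇒universal {m} P step {z₀} Pz₀ = <-weakInduction P P-zero step-suc
  where
  step-suc : ∀ i → P (inject₁ i) → P (suc i)
  step-suc i = subst P (next-prev (suc i)) ∘ step (inject₁ i)
  P-zero : P zero
  P-zero = subst P (next-prev zero)
    (step (fromℕ m) (<-weakInduction-startingFrom P Pz₀ step-suc (≤fromℕ z₀)))

Cycle-sym : ∀ {n} {i j : Fin n} → Cycle n i j → Cycle n j i
Cycle-sym (inj₁ eq)               = inj₂ (inj₁ eq)
Cycle-sym (inj₂ (inj₁ eq))        = inj₁ eq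
Cycle-sym (inj₂ (inj₂ (inj₁ eq))) = inj₂ (inj₂ (inj₂ eq))
Cycle-sym (inj₂ (inj₂ (inj₂ eq))) = inj₂ (inj₂ (inj₁ eq))

Cycle-prev : (j : Fin (suc m)) → Cycle (suc m) (prev j) j
Cycle-prev {m} zero = inj₂ (inj₂ (inj₁ (refl , cong suc (toℕ-fromℕ m))))
Cycle-prev (suc j)  = inj₁ (cong suc (sym (toℕ-inject₁ j)))

Cycle-next : (i : Fin (suc m)) → Cycle (suc m) i (next i)
Cycle-next {m} i = subst (λ x → Cycle (suc m) x (next i)) (prev-next i) (Cycle-prev (next i))

successor⇒prev : ∀ {i j : Fin (suc m)} → toℕ j ≡ suc (toℕ i) → i ≡ prev j
successor⇒prev {j = suc j} eq =
  toℕ-injective (trans (ℕ.suc-injective (sym eq)) (sym (toℕ-inject₁ j)))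

wraparound⇒prev : ∀ {i j : Fin (suc m)} → toℕ j ≡ 0 → suc (toℕ i) ≡ suc m → i ≡ prev j
wraparound⇒prev {m} {j = zero} _ eq =
  toℕ-injective (trans (ℕ.suc-injective eq) (sym (toℕ-fromℕ m)))

Cycle⇒prev : ∀ {i j : Fin (suc m)} → Cycle (suc m) i j → i ≡ prev j ⊎ j ≡ prev i
Cycle⇒prev (inj₁ eq)                       = inj₁ (successor⇒prev eq)
Cycle⇒prev (inj₂ (inj₁ eq))                = inj₂ (successor⇒prev eq)
Cycle⇒prev (inj₂ (inj₂ (inj₁ (j≡0 , eq)))) = inj₁ (wraparound⇒prev j≡0 eq)
Cycle⇒prev (inj₂ (inj₂ (inj₂ (i≡0 , eq)))) = inj₂ (wraparound⇒prev i≡0 eq)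

Cycle⇒prev⊎next : ∀ {i j : Fin (suc m)} → Cycle (suc m) i j → j ≡ prev i ⊎ j ≡ next i
Cycle⇒prev⊎next {j = j} i~j with Cycle⇒prev i~j
... | inj₁ i≡prev = inj₂ (trans (sym (next-prev j)) (cong next (sym i≡prev)))
... | inj₂ j≡prev = inj₁ j≡prev

singleton-not-dominating : 3 ≤ m → (S : VSet (suc m)) → ¬ SingletonDominating (Cycle (suc m)) S
singleton-not-dominating 3≤m _ ((v , S≐v) , dom)
  with fresh (v ∷ prev v ∷ next v ∷ []) (s≤s 3≤m)
... | w , w≢v ∷ w≢prev ∷ w≢next ∷ [] with dom w (w≢v ∘ proj₁ (S≐v w))
...   | u , Su , w~u with proj₁ (S≐v u) Su
...     | refl = [ w≢prev , w≢next ] (Cycle⇒prev⊎next (Cycle-sym w~u))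

perfect⇒unique-neighbour : ∀ {n} {G : Graph n} {S : VSet n} {v u w} → PerfectDominating G S →
  ¬ S v → S u → G v u → S w → G v w → u ≡ w
perfect⇒unique-neighbour perfect v∉S Su v~u Sw v~w with perfect _ v∉S
... | _ , _ , _ , unique = trans (unique _ Su v~u) (sym (unique _ Sw v~w))

module Coalitions (f : Fin (suc m) → Fin k) where

  infix 4 _~_
  _~_ : Fin k → Fin k → Set
  i ~ j = PerfectCoalition (Cycle (suc m)) (Class (Cycle (suc m)) f i) (Class (Cycle (suc m)) f j)

  classesAround : Fin (suc m) → Fin k × Fin k × Fin k
  classesAround z = f (prev z) , f z , f (next z)

  meets-classesAround : ∀ {i j} → i ~ j → ∀ v → i ∈₃ classesAround v ⊎ j ∈₃ classesAround v
  meets-classesAround {i} {j} (_ , _ , _ , _ , _ , perfect) v with (f v ≟ i) ⊎-dec (f v ≟ j)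
  ... | yes fv∈ = Sum.map (λ e → inj₂ (inj₁ (sym e))) (λ e → inj₂ (inj₁ (sym e))) fv∈
  ... | no fv∉ with perfect v fv∉
  ...   | u , fu∈ , v~u , _ with Cycle⇒prev⊎next v~u
  ...     | inj₁ refl = Sum.map (λ e → inj₁ (sym e)) (λ e → inj₁ (sym e)) fu∈
  ...     | inj₂ refl = Sum.map (λ e → inj₂ (inj₂ (sym e))) (λ e → inj₂ (inj₂ (sym e))) fu∈

  non-dominating⇒missed : ∀ {c} → ¬ Dominating (Cycle (suc m)) (Class (Cycle (suc m)) f c) →
    ∃ λ z → ¬ c ∈₃ classesAround z
  non-dominating⇒missed {c} ¬dom =
    ¬∀⟶∃¬ (suc m) (λ z → c ∈₃ classesAround z) around? (¬dom ∘ dominating)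
    where
    around? : ∀ z → Dec (c ∈₃ classesAround z)
    around? z = (c ≟ f (prev z)) ⊎-dec (c ≟ f z) ⊎-dec (c ≟ f (next z))
    dominating : (∀ z → c ∈₃ classesAround z) →
      Dominating (Cycle (suc m)) (Class (Cycle (suc m)) f c)
    dominating everywhere v fv≢c with everywhere v
    ... | inj₁ c≡        = prev v , sym c≡ , Cycle-sym (Cycle-prev v)
    ... | inj₂ (inj₁ c≡) = ⊥-elim (fv≢c (sym c≡))
    ... | inj₂ (inj₂ c≡) = next v , sym c≡ , Cycle-next v

  partner-off-centre : ∀ {c d z} → 2 ≤ m → d ~ c → ¬ c ∈₃ classesAround z →
    f (next (next z)) ≡ c → d ∈₂ (f (prev z) , f (next z))
  partner-off-centre {d = d} {z} 2≤m d~c@(_ , _ , _ , _ , _ , perfect) c∉N fnnz≡c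
    with meets-classesAround d~c z
  ... | inj₂ c∈N               = ⊥-elim (c∉N c∈N)
  ... | inj₁ (inj₁ d≡)         = inj₁ d≡
  ... | inj₁ (inj₂ (inj₂ d≡))  = inj₂ d≡
  ... | inj₁ (inj₂ (inj₁ d≡fz)) with f (next z) ≟ d
  ...   | yes fnz≡d = inj₂ (sym fnz≡d)
  ...   | no fnz≢d  = ⊥-elim (next∘next≢id 2≤m z (sym
          (perfect⇒unique-neighbour perfect
            [ fnz≢d , (λ fnz≡c → c∉N (inj₂ (inj₂ (sym fnz≡c)))) ]
            (inj₁ (sym d≡fz)) (Cycle-sym (Cycle-next z))
            (inj₂ fnnz≡c) (Cycle-next (next z)))))

  ¬three-partners : ∀ {c d₁ d₂ d₃} → 2 ≤ m → Surjective _≡_ _≡_ f →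
    d₁ ~ c → d₂ ~ c → d₃ ~ c → d₁ ≢ d₂ → d₁ ≢ d₃ → d₂ ≢ d₃ → ⊥
  ¬three-partners {c} 2≤m surj d₁~c@(_ , _ , c-non-dominating , _) d₂~c d₃~c
    d₁≢d₂ d₁≢d₃ d₂≢d₃ =
    next-closed⇒universal (λ z → ¬ c ∈₃ classesAround z) step
      (proj₂ (non-dominating⇒missed c-non-dominating))
      (proj₁ (surj c)) (inj₂ (inj₁ (sym (proj₂ (surj c) refl))))
    where
    step : ∀ z → ¬ c ∈₃ classesAround z → ¬ c ∈₃ classesAround (next z)
    step z c∉N (inj₁ c≡)        = c∉N (inj₂ (inj₁ (trans c≡ (cong f (prev-next z)))))
    step z c∉N (inj₂ (inj₁ c≡)) = c∉N (inj₂ (inj₂ c≡))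
    step z c∉N (inj₂ (inj₂ c≡)) = ¬three-distinct-in-pair d₁≢d₂ d₁≢d₃ d₂≢d₃
      (off-centre d₁~c) (off-centre d₂~c) (off-centre d₃~c)
      where
      off-centre : ∀ {d} → d ~ c → d ∈₂ (f (prev z) , f (next z))
      off-centre d~c = partner-off-centre 2≤m d~c c∉N (sym c≡)

  ¬three-disjoint-coalitions-avoiding : ∀ {z a₁ b₁ a₂ b₂ a₃ b₃} → Surjective _≡_ _≡_ f →
    a₁ ~ b₁ → a₂ ~ b₂ → a₃ ~ b₃ →
    Disjoint (a₁ , b₁) (a₂ , b₂) → Disjoint (a₁ , b₁) (a₃ , b₃) → Disjoint (a₂ , b₂) (a₃ , b₃) →
    All (z ≢_) (a₁ ∷ b₁ ∷ a₂ ∷ b₂ ∷ a₃ ∷ b₃ ∷ []) → ⊥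
  ¬three-disjoint-coalitions-avoiding {z} surj a₁~b₁ a₂~b₂ a₃~b₃ d₁₂ d₁₃ d₂₃
    (z≢a₁ ∷ z≢b₁ ∷ z≢a₂ ∷ z≢b₂ ∷ z≢a₃ ∷ z≢b₃ ∷ []) =
    ¬three-disjoint-meeting-pair d₁₂ d₁₃ d₂₃
      (meets-sides a₁~b₁ z≢a₁ z≢b₁) (meets-sides a₂~b₂ z≢a₂ z≢b₂) (meets-sides a₃~b₃ z≢a₃ z≢b₃)
    where
    w : Fin (suc m)
    w = proj₁ (surj z)
    on-side : ∀ {a} → z ≢ a → a ∈₃ classesAround w → f (prev w) ≡ a ⊎ f (next w) ≡ a
    on-side z≢a (inj₁ a≡)        = inj₁ (sym a≡)
    on-side z≢a (inj₂ (inj₁ a≡)) = ⊥-elim (z≢a (trans (sym (proj₂ (surj z) refl)) (sym a≡)))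
    on-side z≢a (inj₂ (inj₂ a≡)) = inj₂ (sym a≡)
    meets-sides : ∀ {a b} → a ~ b → z ≢ a → z ≢ b →
      f (prev w) ∈₂ (a , b) ⊎ f (next w) ∈₂ (a , b)
    meets-sides a~b z≢a z≢b with meets-classesAround a~b w
    ... | inj₁ a∈N = Sum.map inj₁ inj₁ (on-side z≢a a∈N)
    ... | inj₂ b∈N = Sum.map inj₂ inj₂ (on-side z≢b b∈N)

  has-partner : 3 ≤ m → IsPRCPartition (Cycle (suc m)) k f → ∀ i → ∃ (i ~_)
  has-partner 3≤m (_ , classes) i with classes i
  ... | inj₁ singleton     = ⊥-elim (singleton-not-dominating 3≤m _ singleton)
  ... | inj₂ (j , _ , i~j) = j , i~j

module PartnerGraph
  {k : ℕ} (_~_ : Fin k → Fin k → Set)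
  (partner : Fin k → Fin k) (~-partner : ∀ x → x ~ partner x)
  (¬three-partners : ∀ {c d₁ d₂ d₃} → d₁ ~ c → d₂ ~ c → d₃ ~ c →
    d₁ ≢ d₂ → d₁ ≢ d₃ → d₂ ≢ d₃ → ⊥)
  (¬three-disjoint-edges-avoiding : ∀ {z a₁ b₁ a₂ b₂ a₃ b₃} → a₁ ~ b₁ → a₂ ~ b₂ → a₃ ~ b₃ →
    Disjoint (a₁ , b₁) (a₂ , b₂) → Disjoint (a₁ , b₁) (a₃ , b₃) → Disjoint (a₂ , b₂) (a₃ , b₃) →
    All (z ≢_) (a₁ ∷ b₁ ∷ a₂ ∷ b₂ ∷ a₃ ∷ b₃ ∷ []) → ⊥)
  (h₁ h₂ h₃ : Fin k)
  (edge-meets-hubs : ∀ {x y} → x ~ y → x ∈₃ (h₁ , h₂ , h₃) ⊎ y ∈₃ (h₁ , h₂ , h₃))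
  where

  hubs : List (Fin k)
  hubs = h₁ ∷ h₂ ∷ h₃ ∷ []

  NonHub : Fin k → Set
  NonHub x = All (x ≢_) hubs

  nonHub≢hub : ∀ {x h} → NonHub x → h ∈₃ (h₁ , h₂ , h₃) → x ≢ h
  nonHub≢hub (x≢h₁ ∷ _)         (inj₁ refl)        = x≢h₁
  nonHub≢hub (_ ∷ x≢h₂ ∷ _)     (inj₂ (inj₁ refl)) = x≢h₂
  nonHub≢hub (_ ∷ _ ∷ x≢h₃ ∷ _) (inj₂ (inj₂ refl)) = x≢h₃

  nonHub~⇒hub : ∀ {x A} → NonHub x → x ~ A → A ∈₃ (h₁ , h₂ , h₃)
  nonHub~⇒hub nx x~A with edge-meets-hubs x~A
  ... | inj₁ x∈ = ⊥-elim (nonHub≢hub nx x∈ refl)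
  ... | inj₂ A∈ = A∈

  spokes-disjoint : ∀ {x A x′ A′} → NonHub x → x ~ A → NonHub x′ → x′ ~ A′ →
    x ≢ x′ → A ≢ A′ → Disjoint (x , A) (x′ , A′)
  spokes-disjoint nx x~A nx′ x′~A′ x≢x′ A≢A′ =
    x≢x′ ,
    nonHub≢hub nx (nonHub~⇒hub nx′ x′~A′) ,
    (λ A≡x′ → nonHub≢hub nx′ (nonHub~⇒hub nx x~A) (sym A≡x′)) ,
    A≢A′

  partner≢saturated : ∀ {x₁ x₂ x A} → x₁ ~ A → x₂ ~ A →
    x₂ ≢ x₁ → x ≢ x₁ → x ≢ x₂ → partner x ≢ A
  partner≢saturated {x = x} x₁~A x₂~A x₂≢x₁ x≢x₁ x≢x₂ pX≡A =
    ¬three-partners x₁~A x₂~A (subst (x ~_) pX≡A (~-partner x))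
      (≢-sym x₂≢x₁) (≢-sym x≢x₁) (≢-sym x≢x₂)

  module _ (7≤k : 7 ≤ k) where

    pick : (xs : List (Fin k)) → {True (length xs ≤? 6)} → ∃ λ y → All (y ≢_) xs
    pick xs {|xs|≤6} = fresh xs (≤-trans (s≤s (toWitness |xs|≤6)) 7≤k)

    ¬three-disjoint-edges : ∀ {a₁ b₁ a₂ b₂ a₃ b₃} → a₁ ~ b₁ → a₂ ~ b₂ → a₃ ~ b₃ →
      Disjoint (a₁ , b₁) (a₂ , b₂) → Disjoint (a₁ , b₁) (a₃ , b₃) → Disjoint (a₂ , b₂) (a₃ , b₃) → ⊥
    ¬three-disjoint-edges e₁ e₂ e₃ d₁₂ d₁₃ d₂₃ =
      ¬three-disjoint-edges-avoiding e₁ e₂ e₃ d₁₂ d₁₃ d₂₃ (proj₂ (pick _))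

    ¬edge-beside-spokes : ∀ {y q x A x′ B} → y ~ q →
      NonHub x → x ~ A → NonHub x′ → x′ ~ B → x ≢ x′ → A ≢ B →
      All (y ≢_) (x ∷ A ∷ x′ ∷ B ∷ []) → All (q ≢_) (x ∷ A ∷ x′ ∷ B ∷ []) → ⊥
    ¬edge-beside-spokes y~q nx x~A nx′ x′~B x≢x′ A≢B
      (y≢x ∷ y≢A ∷ y≢x′ ∷ y≢B ∷ []) (q≢x ∷ q≢A ∷ q≢x′ ∷ q≢B ∷ []) =
      ¬three-disjoint-edges y~q x~A x′~B
        (y≢x , y≢A , q≢x , q≢A) (y≢x′ , y≢B , q≢x′ , q≢B) (spokes-disjoint nx x~A nx′ x′~B x≢x′ A≢B)

    ¬two-saturated-hubs : ∀ {x₁ x₂ x₃ x₄ A B} → NonHub x₁ → NonHub x₂ → NonHub x₃ → NonHub x₄ →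
      x₂ ≢ x₁ → x₃ ≢ x₁ → x₃ ≢ x₂ → x₄ ≢ x₁ → x₄ ≢ x₂ → x₄ ≢ x₃ →
      x₁ ~ A → x₂ ~ A → x₃ ~ B → x₄ ~ B → A ≢ B → ⊥
    ¬two-saturated-hubs {x₁} {x₂} {x₃} {x₄} {A} {B} nx₁ nx₂ nx₃ nx₄
      x₂≢x₁ x₃≢x₁ x₃≢x₂ x₄≢x₁ x₄≢x₂ x₄≢x₃ x₁~A x₂~A x₃~B x₄~B A≢B
      with pick (A ∷ B ∷ x₁ ∷ x₂ ∷ x₃ ∷ x₄ ∷ [])
    ... | y , y≢A ∷ y≢B ∷ y≢x₁ ∷ y≢x₂ ∷ y≢x₃ ∷ y≢x₄ ∷ [] =
      beside (~-partner y)
        (partner≢saturated x₁~A x₂~A x₂≢x₁ y≢x₁ y≢x₂) (partner≢saturated x₃~B x₄~B x₄≢x₃ y≢x₃ y≢x₄)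
      where
      -- the partner q of y may be x₁ or x₃, but then the spoke of x₂ resp. x₄ avoids it
      beside : ∀ {q} → y ~ q → q ≢ A → q ≢ B → ⊥
      beside {q} y~q q≢A q≢B with q ≟ x₁ | q ≟ x₃
      ... | yes refl | _ =
        ¬edge-beside-spokes y~q nx₂ x₂~A nx₃ x₃~B (≢-sym x₃≢x₂) A≢B
          (y≢x₂ ∷ y≢A ∷ y≢x₃ ∷ y≢B ∷ []) (≢-sym x₂≢x₁ ∷ q≢A ∷ ≢-sym x₃≢x₁ ∷ q≢B ∷ [])
      ... | no _ | yes refl =
        ¬edge-beside-spokes y~q nx₁ x₁~A nx₄ x₄~B (≢-sym x₄≢x₁) A≢B
          (y≢x₁ ∷ y≢A ∷ y≢x₄ ∷ y≢B ∷ []) (x₃≢x₁ ∷ q≢A ∷ ≢-sym x₄≢x₃ ∷ q≢B ∷ [])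
      ... | no q≢x₁ | no q≢x₃ =
        ¬edge-beside-spokes y~q nx₁ x₁~A nx₃ x₃~B (≢-sym x₃≢x₁) A≢B
          (y≢x₁ ∷ y≢A ∷ y≢x₃ ∷ y≢B ∷ []) (q≢x₁ ∷ q≢A ∷ q≢x₃ ∷ q≢B ∷ [])

    ¬saturated-hub : ∀ {x₁ x₂ A} → NonHub x₁ → NonHub x₂ → x₂ ≢ x₁ → x₁ ~ A → x₂ ~ A → ⊥
    ¬saturated-hub {x₁} {x₂} nx₁ nx₂ x₂≢x₁ x₁~A x₂~A
      with pick (x₁ ∷ x₂ ∷ hubs)
    ... | x₃ , x₃≢x₁ ∷ x₃≢x₂ ∷ nx₃ with pick (x₁ ∷ x₂ ∷ x₃ ∷ hubs)
    ... | x₄ , x₄≢x₁ ∷ x₄≢x₂ ∷ x₄≢x₃ ∷ nx₄ with partner x₄ ≟ partner x₃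
    ... | yes D≡B =
      ¬two-saturated-hubs nx₁ nx₂ nx₃ nx₄ x₂≢x₁ x₃≢x₁ x₃≢x₂ x₄≢x₁ x₄≢x₂ x₄≢x₃
        x₁~A x₂~A (~-partner x₃) (subst (x₄ ~_) D≡B (~-partner x₄))
        (≢-sym (partner≢saturated x₁~A x₂~A x₂≢x₁ x₃≢x₁ x₃≢x₂))
    ... | no D≢B =
      ¬three-disjoint-edges x₁~A (~-partner x₃) (~-partner x₄)
        (spokes-disjoint nx₁ x₁~A nx₃ (~-partner x₃) (≢-sym x₃≢x₁)
          (≢-sym (partner≢saturated x₁~A x₂~A x₂≢x₁ x₃≢x₁ x₃≢x₂)))
        (spokes-disjoint nx₁ x₁~A nx₄ (~-partner x₄) (≢-sym x₄≢x₁)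
          (≢-sym (partner≢saturated x₁~A x₂~A x₂≢x₁ x₄≢x₁ x₄≢x₂)))
        (spokes-disjoint nx₃ (~-partner x₃) nx₄ (~-partner x₄) (≢-sym x₄≢x₃) (≢-sym D≢B))

    ¬three-nonHubs : ∀ {x₁ x₂ x₃} → NonHub x₁ → NonHub x₂ → NonHub x₃ →
      x₂ ≢ x₁ → x₃ ≢ x₁ → x₃ ≢ x₂ → ⊥
    ¬three-nonHubs {x₁} {x₂} {x₃} nx₁ nx₂ nx₃ x₂≢x₁ x₃≢x₁ x₃≢x₂
      with partner x₂ ≟ partner x₁ | partner x₃ ≟ partner x₁ | partner x₃ ≟ partner x₂
    ... | yes same | _ | _ =
      ¬saturated-hub nx₁ nx₂ x₂≢x₁ (~-partner x₁) (subst (x₂ ~_) same (~-partner x₂))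
    ... | no _ | yes same | _ =
      ¬saturated-hub nx₁ nx₃ x₃≢x₁ (~-partner x₁) (subst (x₃ ~_) same (~-partner x₃))
    ... | no _ | no _ | yes same =
      ¬saturated-hub nx₂ nx₃ x₃≢x₂ (~-partner x₂) (subst (x₃ ~_) same (~-partner x₃))
    ... | no p₂≢p₁ | no p₃≢p₁ | no p₃≢p₂ =
      ¬three-disjoint-edges (~-partner x₁) (~-partner x₂) (~-partner x₃)
        (spoke nx₁ nx₂ x₂≢x₁ p₂≢p₁) (spoke nx₁ nx₃ x₃≢x₁ p₃≢p₁) (spoke nx₂ nx₃ x₃≢x₂ p₃≢p₂)
      where
      spoke : ∀ {x x′} → NonHub x → NonHub x′ → x′ ≢ x → partner x′ ≢ partner x →
        Disjoint (x , partner x) (x′ , partner x′)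
      spoke nx nx′ x′≢x p′≢p =
        spokes-disjoint nx (~-partner _) nx′ (~-partner _) (≢-sym x′≢x) (≢-sym p′≢p)

    contradiction : ⊥
    contradiction with pick hubs
    ... | x₁ , nx₁ with pick (x₁ ∷ hubs)
    ... | x₂ , x₂≢x₁ ∷ nx₂ with pick (x₁ ∷ x₂ ∷ hubs)
    ... | x₃ , x₃≢x₁ ∷ x₃≢x₂ ∷ nx₃ = ¬three-nonHubs nx₁ nx₂ nx₃ x₂≢x₁ x₃≢x₁ x₃≢x₂

  k≤6 : k ≤ 6
  k≤6 with k ≤? 6
  ... | yes k≤6 = k≤6
  ... | no k≰6  = ⊥-elim (contradiction (≰⇒> k≰6))

corollary3p5 : (n : ℕ) → 3 ≤ n → (k : ℕ) → (f : Fin n → Fin k) →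
    IsPRCPartition (Cycle n) k f → k ≤ 6
corollary3p5 n 3≤n k f prc@(surj , _) with m≤n⇒m<n∨m≡n 3≤n
... | inj₂ refl = ≤-trans (surjective⇒≤ surj) (m≤m+n 3 3)
... | inj₁ (s≤s 3≤m) =
  PartnerGraph.k≤6 _~_ (proj₁ ∘ has-partner 3≤m prc) (proj₂ ∘ has-partner 3≤m prc)
    (¬three-partners (ℕ.<⇒≤ 3≤m) surj) (¬three-disjoint-coalitions-avoiding surj)
    (f (prev zero)) (f zero) (f (next zero)) (λ i~j → meets-classesAround i~j zero)
  where open Coalitions f
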